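{- Let $\Gamma$ be a weakly separable finite cc0-language over $D$ and let $I$ be an instance of $\mathrm{CCSP}(\Gamma)$ or $\mathrm{OCSP}(\Gamma)$. (1) Every satisfying assignment $f$ of $I$ is the union of pairwise disjoint minimal satisfying assignments. (2) If there is a satisfying assignment $f$ with $f(v)=d$ for some variable $v$ and some nonzero $d\in D$, then there is a minimal satisfying assignment $f'$ with $f'(v)=d$.
   Context: $D$ is finite with distinguished $0$; $\Gamma$ a finite set of relations on $D$. A $\mathrm{CSP}(\Gamma)$ instance (the underlying instance of $\mathrm{CCSP}$/$\mathrm{OCSP}$) is $(V,\mathcal C)$ with constraints $\langle(s_1,..,s_n),R\rangle$, $R\in\Gamma$; $\tau:V\to D$ is satisfying if it satisfies every constraint (size/cardinality requirements are not required). $\Gamma$ is a cc0-language if all its relations contain the all-zero tuple and every relation containing the all-zero tuple obtained from a relation of $\Gamma$ by substituting constants for some coordinates belongs to $\Gamma$. Tuples (or assignments, viewed as tuples) are disjoint if at each coordinate at least one is $0$; their union takes the nonzero value at each coordinate. A 0-valid relation $R$ is weakly separable if for all disjoint $\mathbf t_1,\mathbf t_2$: $\mathbf t_1,\mathbf t_2\in R\Rightarrow\mathbf t_1+\mathbf t_2\in R$, and $\mathbf t_2,\mathbf t_1+\mathbf t_2\in R\Rightarrow\mathbf t_1\in R$; $\Gamma$ is weakly separable if all its relations are. $f'$ is an extension of $f$ if $f'(v)=f(v)$ whenever $f(v)\ne0$. A minimal satisfying assignment is a satisfying assignment that is not identically zero and is not a proper extension of any other satisfying assignment that is not identically zero.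 -}

module Defs where

open import Data.Nat using (ℕ; zero; suc)
open import Data.Fin using (Fin; zero; suc)
open import Data.Bool using (Bool; true; false)
open import Data.Maybe using (Maybe; just; nothing)
open import Data.Vec using (Vec; []; _∷_; replicate; lookup; zipWith; map)
open import Data.List using (List; []; _∷_; foldr)
open import Data.List.Membership.Propositional using (_∈_)
open import Data.List.Relation.Unary.Any using (Any)
open import Data.List.Relation.Unary.All using (All)
open import Data.List.Relation.Unary.AllPairs using (AllPairs)
open import Data.Product using (Σ; ∃; _×_; _,_)
open import Data.Sum using (_⊎_)
open import Relation.Binary.PropositionalEquality using (_≡_; _≢_; subst)
open import Relation.Nullary using (¬_)

-- The finite domain D with distinguished element 0 is modelled as Fin (suc k),
-- the distinguished element being  zero.
Dom : ℕ → Set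
Dom k = Fin (suc k)

record Rel (k : ℕ) : Set where
  constructor rel
  field
    arity : ℕ
    holds : Vec (Dom k) arity → Bool
open Rel public

𝟎 : ∀ {k} n → Vec (Dom k) n
𝟎 n = replicate n zero

ZeroValid : ∀ {k} → Rel k → Set
ZeroValid R = holds R (𝟎 (arity R)) ≡ true

-- union of domain values (nonzero value wins; only meaningful when disjoint)
_⊔_ : ∀ {k} → Dom k → Dom k → Dom k
zero  ⊔ b = b
suc a ⊔ b = suc a

DisjointT : ∀ {k n} → Vec (Dom k) n → Vec (Dom k) n → Set
DisjointT t₁ t₂ = ∀ i → lookup t₁ i ≡ zero ⊎ lookup t₂ i ≡ zero

_∪T_ : ∀ {k n} → Vec (Dom k) n → Vec (Dom k) n → Vec (Dom k) n
t₁ ∪T t₂ = zipWith _⊔_ t₁ t₂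

WeaklySeparableRel : ∀ {k} → Rel k → Set
WeaklySeparableRel R =
  ZeroValid R ×
  (∀ (t₁ t₂ : Vec _ (arity R)) → DisjointT t₁ t₂ →
     (holds R t₁ ≡ true → holds R t₂ ≡ true → holds R (t₁ ∪T t₂) ≡ true) ×
     (holds R t₂ ≡ true → holds R (t₁ ∪T t₂) ≡ true → holds R t₁ ≡ true))

WeaklySeparable : ∀ {k} → List (Rel k) → Set
WeaklySeparable Γ = All WeaklySeparableRel Γ

-- Substituting constants for some coordinates: a pattern  c : Vec (Maybe D) n,
-- where  just d  fixes the coordinate to  d  and  nothing  keeps it free.
free : ∀ {k n} → Vec (Maybe (Dom k)) n → ℕ
free []            = zero
free (nothing ∷ c) = suc (free c)
free (just _ ∷ c)  = free c

fill : ∀ {k n} (c : Vec (Maybe (Dom k)) n) → Vec (Dom k) (free c) → Vec (Dom k) n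
fill []            xs       = []
fill (nothing ∷ c) (x ∷ xs) = x ∷ fill c xs
fill (just d ∷ c)  xs       = d ∷ fill c xs

substConst : ∀ {k} (R : Rel k) → Vec (Maybe (Dom k)) (arity R) → Rel k
substConst R c = rel (free c) (λ t → holds R (fill c t))

SameRel : ∀ {k} → Rel k → Rel k → Set
SameRel R S = Σ (arity R ≡ arity S) λ e →
  ∀ t → holds R t ≡ holds S (subst (Vec _) e t)

_∈Γ_ : ∀ {k} → Rel k → List (Rel k) → Set
R ∈Γ Γ = Any (SameRel R) Γ

CC0 : ∀ {k} → List (Rel k) → Set
CC0 Γ = All ZeroValid Γ ×
  (∀ R → R ∈ Γ → ∀ (c : Vec (Maybe _) (arity R)) →
     ZeroValid (substConst R c) → substConst R c ∈Γ Γ)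

record Constraint (k : ℕ) (Γ : List (Rel k)) (m : ℕ) : Set where
  field
    R     : Rel k
    R∈Γ   : R ∈ Γ
    scope : Vec (Fin m) (arity R)
open Constraint public

Instance : (k : ℕ) → List (Rel k) → ℕ → Set
Instance k Γ m = List (Constraint k Γ m)

Assignment : ℕ → ℕ → Set
Assignment k m = Fin m → Dom k

SatC : ∀ {k Γ m} → Assignment k m → Constraint k Γ m → Set
SatC τ C = holds (R C) (map τ (scope C)) ≡ true

Satisfying : ∀ {k Γ m} → Instance k Γ m → Assignment k m → Set
Satisfying I τ = All (SatC τ) I

IdZero : ∀ {k m} → Assignment k m → Set
IdZero f = ∀ v → f v ≡ zero

Extends : ∀ {k m} → Assignment k m → Assignment k m → Set
Extends f' f = ∀ v → f v ≢ zero → f' v ≡ f v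

Minimal : ∀ {k Γ m} → Instance k Γ m → Assignment k m → Set
Minimal I f = Satisfying I f × ¬ IdZero f ×
  (∀ g → Satisfying I g → ¬ IdZero g → Extends f g → ∀ v → f v ≡ g v)

DisjointA : ∀ {k m} → Assignment k m → Assignment k m → Set
DisjointA f g = ∀ v → f v ≡ zero ⊎ g v ≡ zero

⋃ : ∀ {k m} → List (Assignment k m) → Assignment k m
⋃ fs v = foldr (λ f a → f v ⊔ a) zero fs

module Submission where

-- Write  g ≼ h  ("g is a sub-assignment of h") when h extends g, i.e. h agrees
-- with g wherever g is nonzero.  The proof has three ingredients.
--  * Separation: if f and g satisfy I and g ≼ f, then the difference f ∖ g
--    (f with the support of g set to zero) also satisfies I.  This is the
--    second closure property of weak separability, applied constraint-wise
--    to the disjoint tuples  f ∖ g  and  g  whose union is  f.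
--  * Minimality is decidable by search: every sub-assignment of h is a
--    restriction  h ↾ M  of h to a subset M of the variables, and there are
--    finitely many M.  So a nonzero satisfying h is either minimal or has a
--    proper nonzero satisfying sub-assignment, of strictly smaller support.
--  * Well-founded induction on the support size then yields a minimal
--    assignment below every nonzero satisfying f (descent), and splitting off
--    such a minimal g and recursing on f ∖ g decomposes f (part 1).
-- Part 2 follows: the component of the decomposition that is nonzero at v
-- carries the value f v.

open import Defs
open import Data.Nat using (ℕ)
open import Data.Fin using (Fin; zero)
open import Data.List using (List)
open import Data.List.Relation.Unary.All using (All)
open import Data.List.Relation.Unary.AllPairs using (AllPairs)
open import Data.Product using (Σ; ∃; _×_)
open import Relation.Binary.PropositionalEquality using (_≡_; _≢_)

open import Data.Nat using (_<_)
open import Data.Nat.Induction using (<-wellFounded)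
open import Data.Fin using (suc)
open import Data.Fin.Properties using (all?; any?; ¬∀⟶∃¬) renaming (_≟_ to _≟F_)
open import Data.Fin.Subset using (Subset; _∈_; _⊆_; ∣_∣)
open import Data.Fin.Subset.Properties using (anySubset?; p⊂q⇒∣p∣<∣q∣)
open import Data.Bool using (Bool; true; false; if_then_else_)
open import Data.Bool.Properties using () renaming (_≟_ to _≟B_)
open import Data.Vec using (Vec; []; _∷_; lookup; tabulate; map)
open import Data.Vec.Properties using (map-cong; lookup∘tabulate; []=⇒lookup; lookup⇒[]=)
open import Data.List using ([]; _∷_)
open import Data.List.Membership.Propositional using () renaming (_∈_ to _∈ₗ_)
open import Data.List.Relation.Unary.Any using (here; there)
import Data.List.Relation.Unary.All as All
open import Data.List.Relation.Unary.All using ([]; _∷_)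
open import Data.List.Relation.Unary.AllPairs using ([]; _∷_)
open import Data.Product using (_,_; proj₁; proj₂)
open import Data.Sum using (_⊎_; inj₁; inj₂)
open import Function using (_∘_; _on_)
open import Induction.WellFounded using (Acc; acc; WellFounded)
open import Relation.Binary.Construct.On using (wellFounded)
open import Relation.Binary.PropositionalEquality using (refl; sym; trans; cong; _≗_)
open import Relation.Nullary using (¬_; Dec; yes; no; contradiction)
open import Relation.Nullary.Decidable using (_×-dec_; ¬?)

isNonzero : ∀ {k} → Dom k → Bool
isNonzero zero    = false
isNonzero (suc _) = true

isNonzero⁺ : ∀ {k} (a : Dom k) → a ≢ zero → isNonzero a ≡ true
isNonzero⁺ zero    a≢0 = contradiction refl a≢0
isNonzero⁺ (suc _) _   = refl

isNonzero⁻ : ∀ {k} (a : Dom k) → isNonzero a ≡ true → a ≢ zero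
isNonzero⁻ (suc _) _ ()

_⊖_ : ∀ {k} → Dom k → Dom k → Dom k
a ⊖ zero  = a
a ⊖ suc _ = zero

⊔-zero⁻ : ∀ {k} (a b : Dom k) → a ⊔ b ≡ zero → a ≡ zero × b ≡ zero
⊔-zero⁻ zero b b≡0 = refl , b≡0

⊔-comm-disjoint : ∀ {k} {a b : Dom k} → a ≡ zero ⊎ b ≡ zero → a ⊔ b ≡ b ⊔ a
⊔-comm-disjoint {a = zero}  {zero}  _        = refl
⊔-comm-disjoint {a = zero}  {suc _} _        = refl
⊔-comm-disjoint {a = suc _} {zero}  _        = refl
⊔-comm-disjoint {a = suc _} {suc _} (inj₁ ())
⊔-comm-disjoint {a = suc _} {suc _} (inj₂ ())

⊖-disjoint : ∀ {k} (a b : Dom k) → a ⊖ b ≡ zero ⊎ b ≡ zero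
⊖-disjoint a zero    = inj₂ refl
⊖-disjoint a (suc _) = inj₁ refl

⊖-erases : ∀ {k} (a b : Dom k) → b ≢ zero → a ⊖ b ≡ zero
⊖-erases a zero    b≢0 = contradiction refl b≢0
⊖-erases a (suc _) _   = refl

⊖-⊔ : ∀ {k} (a b : Dom k) → (b ≢ zero → a ≡ b) → (a ⊖ b) ⊔ b ≡ a
⊖-⊔ zero    zero    _   = refl
⊖-⊔ (suc _) zero    _   = refl
⊖-⊔ a       (suc b) a≡b = sym (a≡b λ ())

module _ {k m : ℕ} where

  _≼_ : Assignment k m → Assignment k m → Set
  g ≼ h = Extends h g

  ≼-trans : {f g h : Assignment k m} → f ≼ g → g ≼ h → f ≼ h
  ≼-trans {f} {g} f≼g g≼h v fv≢0 = trans (g≼h v gv≢0) gv≡fv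
    where
    gv≡fv : g v ≡ f v
    gv≡fv = f≼g v fv≢0
    gv≢0 : g v ≢ zero
    gv≢0 gv≡0 = fv≢0 (trans (sym gv≡fv) gv≡0)

  _∖_ : Assignment k m → Assignment k m → Assignment k m
  (f ∖ g) v = f v ⊖ g v

  ∖-≼ : (f g : Assignment k m) → (f ∖ g) ≼ f
  ∖-≼ f g v nz with g v
  ... | zero  = refl
  ... | suc _ = contradiction refl nz

  ∖-disjoint : (f g : Assignment k m) → DisjointA (f ∖ g) g
  ∖-disjoint f g v = ⊖-disjoint (f v) (g v)

  ∖-⊔ : {f g : Assignment k m} → g ≼ f → ∀ v → (f ∖ g) v ⊔ g v ≡ f v
  ∖-⊔ {f} {g} g≼f v = ⊖-⊔ (f v) (g v) (g≼f v)

  _↾_ : Assignment k m → Subset m → Assignment k m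
  (h ↾ M) v = if lookup M v then h v else zero

  ↾-≼ : (h : Assignment k m) (M : Subset m) → (h ↾ M) ≼ h
  ↾-≼ h M v nz with lookup M v
  ... | true  = refl
  ... | false = contradiction refl nz

  supp : Assignment k m → Subset m
  supp h = tabulate (isNonzero ∘ h)

  size : Assignment k m → ℕ
  size h = ∣ supp h ∣

  ∈-supp⁺ : (h : Assignment k m) {v : Fin m} → h v ≢ zero → v ∈ supp h
  ∈-supp⁺ h {v} hv≢0 = lookup⇒[]= v (supp h) (trans (lookup∘tabulate (isNonzero ∘ h) v) (isNonzero⁺ (h v) hv≢0))

  ∈-supp⁻ : (h : Assignment k m) {v : Fin m} → v ∈ supp h → h v ≢ zero
  ∈-supp⁻ h {v} v∈ = isNonzero⁻ (h v) (trans (sym (lookup∘tabulate (isNonzero ∘ h) v)) ([]=⇒lookup v∈))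

  ≼⇒↾supp : {g h : Assignment k m} → g ≼ h → (h ↾ supp g) ≗ g
  ≼⇒↾supp {g} {h} g≼h v rewrite lookup∘tabulate (isNonzero ∘ g) v with g v | g≼h v
  ... | zero  | _      = refl
  ... | suc _ | hv≡gv = hv≡gv λ ()

  ≼⇒supp⊆ : {g h : Assignment k m} → g ≼ h → supp g ⊆ supp h
  ≼⇒supp⊆ {g} {h} g≼h v∈ =
    ∈-supp⁺ h λ hv≡0 → ∈-supp⁻ g v∈ (trans (sym (g≼h _ (∈-supp⁻ g v∈))) hv≡0)

  shrink-size : {g h : Assignment k m} → g ≼ h → (w : Fin m) → g w ≡ zero → h w ≢ zero →
                size g < size h
  shrink-size {g} {h} g≼h w gw≡0 hw≢0 =
    p⊂q⇒∣p∣<∣q∣ (≼⇒supp⊆ g≼h , w , ∈-supp⁺ h hw≢0 , λ w∈ → ∈-supp⁻ g w∈ gw≡0)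

  _⊏_ : Assignment k m → Assignment k m → Set
  _⊏_ = _<_ on size

  ⊏-wellFounded : WellFounded _⊏_
  ⊏-wellFounded = wellFounded size <-wellFounded

  ⋃-zero⁻ : (fs : List (Assignment k m)) (v : Fin m) → ⋃ fs v ≡ zero → All (λ f → f v ≡ zero) fs
  ⋃-zero⁻ []       v _   = []
  ⋃-zero⁻ (f ∷ fs) v u≡0 with ⊔-zero⁻ (f v) (⋃ fs v) u≡0
  ... | fv≡0 , rest≡0 = fv≡0 ∷ ⋃-zero⁻ fs v rest≡0

  disjoint-⋃ : (g : Assignment k m) (fs : List (Assignment k m)) →
               DisjointA g (⋃ fs) → All (DisjointA g) fs
  disjoint-⋃ g []       _    = []
  disjoint-⋃ g (f ∷ fs) disj = head ∷ disjoint-⋃ g fs tail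
    where
    head : DisjointA g f
    head v with disj v
    ... | inj₁ gv≡0 = inj₁ gv≡0
    ... | inj₂ u≡0  = inj₂ (proj₁ (⊔-zero⁻ (f v) (⋃ fs v) u≡0))
    tail : DisjointA g (⋃ fs)
    tail v with disj v
    ... | inj₁ gv≡0 = inj₁ gv≡0
    ... | inj₂ u≡0  = inj₂ (proj₂ (⊔-zero⁻ (f v) (⋃ fs v) u≡0))

  ⋃-source : (fs : List (Assignment k m)) (v : Fin m) → ⋃ fs v ≢ zero →
             ∃ λ f → f ∈ₗ fs × f v ≡ ⋃ fs v
  ⋃-source []       v u≢0 = contradiction refl u≢0
  ⋃-source (f ∷ fs) v u≢0 with f v in fv
  ... | suc _ = f , here refl , fv
  ... | zero with ⋃-source fs v u≢0
  ...   | g , g∈ , gv = g , there g∈ , gv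

map-⊔ : ∀ {k m n} (s : Vec (Fin m) n) (a b : Assignment k m) →
        map (λ v → a v ⊔ b v) s ≡ map a s ∪T map b s
map-⊔ []      a b = refl
map-⊔ (x ∷ s) a b = cong (a x ⊔ b x ∷_) (map-⊔ s a b)

map-disjoint : ∀ {k m n} (s : Vec (Fin m) n) (a b : Assignment k m) →
               DisjointA a b → DisjointT (map a s) (map b s)
map-disjoint (x ∷ s) a b disj zero    = disj x
map-disjoint (x ∷ s) a b disj (suc i) = map-disjoint s a b disj i

separate : ∀ {k m} (R : Rel k) → WeaklySeparableRel R → (s : Vec (Fin m) (arity R))
           {f g : Assignment k m} → g ≼ f →
           holds R (map f s) ≡ true → holds R (map g s) ≡ true → holds R (map (f ∖ g) s) ≡ true
separate R (_ , sep) s {f} {g} g≼f Rf Rg =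
  proj₂ (sep (map (f ∖ g) s) (map g s) (map-disjoint s (f ∖ g) g (∖-disjoint f g))) Rg Rf∖g∪g
  where
  Rf∖g∪g : holds R (map (f ∖ g) s ∪T map g s) ≡ true
  Rf∖g∪g = trans (cong (holds R) (trans (sym (map-⊔ s (f ∖ g) g)) (map-cong (∖-⊔ g≼f) s))) Rf

module MinimalAssignments {k : ℕ} {Γ : List (Rel k)} (ws : WeaklySeparable Γ) {m : ℕ} (I : Instance k Γ m) where

  satisfying-resp : {a b : Assignment k m} → a ≗ b → Satisfying I a → Satisfying I b
  satisfying-resp a≗b = All.map λ {C} sat → trans (cong (holds (R C)) (sym (map-cong a≗b (scope C)))) sat

  satisfying? : (f : Assignment k m) → Dec (Satisfying I f)
  satisfying? f = All.all? (λ C → holds (R C) (map f (scope C)) ≟B true) I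

  idZero? : (f : Assignment k m) → Dec (IdZero f)
  idZero? f = all? λ v → f v ≟F zero

  satisfying-∖ : {f g : Assignment k m} → g ≼ f → Satisfying I f → Satisfying I g → Satisfying I (f ∖ g)
  satisfying-∖ g≼f satf satg =
    All.zipWith (λ {C} (Rf , Rg) → separate (R C) (All.lookup ws (R∈Γ C)) (scope C) g≼f Rf Rg) (satf , satg)

  ProperSub : Assignment k m → Assignment k m → Set
  ProperSub h g = Satisfying I g × ¬ IdZero g × g ≼ h × ∃ λ w → g w ≡ zero × h w ≢ zero

  ProperRestriction : Assignment k m → Subset m → Set
  ProperRestriction h M = Satisfying I (h ↾ M) × ¬ IdZero (h ↾ M) × ∃ λ w → (h ↾ M) w ≡ zero × h w ≢ zero

  properRestriction? : (h : Assignment k m) (M : Subset m) → Dec (ProperRestriction h M)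
  properRestriction? h M = satisfying? (h ↾ M) ×-dec ¬? (idZero? (h ↾ M)) ×-dec
                           any? (λ w → ((h ↾ M) w ≟F zero) ×-dec ¬? (h w ≟F zero))

  minimal-or-proper : (h : Assignment k m) → Satisfying I h → ¬ IdZero h →
                      Minimal I h ⊎ ∃ (ProperSub h)
  minimal-or-proper h sat nz with anySubset? (properRestriction? h)
  ... | yes (M , satM , nzM , gap) = inj₂ (h ↾ M , satM , nzM , ↾-≼ h M , gap)
  ... | no ¬proper = inj₁ (sat , nz , agrees)
    where
    -- a sub-assignment g of h differing from h at v would be realised by M = supp g
    agrees : ∀ g → Satisfying I g → ¬ IdZero g → g ≼ h → ∀ v → h v ≡ g v
    agrees g satg nzg g≼h v with g v ≟F zero | h v ≟F zero
    ... | no gv≢0  | _        = g≼h v gv≢0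
    ... | yes gv≡0 | yes hv≡0 = trans hv≡0 (sym gv≡0)
    ... | yes gv≡0 | no hv≢0  = contradiction (supp g , satM , nzM , v , trans (h↾M≗g v) gv≡0 , hv≢0) ¬proper
      where
      h↾M≗g : (h ↾ supp g) ≗ g
      h↾M≗g = ≼⇒↾supp g≼h
      satM : Satisfying I (h ↾ supp g)
      satM = satisfying-resp (sym ∘ h↾M≗g) satg
      nzM : ¬ IdZero (h ↾ supp g)
      nzM zeroM = nzg λ u → trans (sym (h↾M≗g u)) (zeroM u)

  minimal-below : (h : Assignment k m) → Satisfying I h → ¬ IdZero h → ∃ λ g → Minimal I g × g ≼ h
  minimal-below h = go h (⊏-wellFounded h)
    where
    go : (h : Assignment k m) → Acc _⊏_ h → Satisfying I h → ¬ IdZero h → ∃ λ g → Minimal I g × g ≼ h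
    go h (acc smaller) sat nz with minimal-or-proper h sat nz
    ... | inj₁ minimal = h , minimal , λ _ _ → refl
    ... | inj₂ (g , satg , nzg , g≼h , w , gw≡0 , hw≢0)
        with go g (smaller (shrink-size g≼h w gw≡0 hw≢0)) satg nzg
    ...   | g′ , minimal , g′≼g = g′ , minimal , ≼-trans g′≼g g≼h

  Decomposition : Assignment k m → Set
  Decomposition f = Σ (List (Assignment k m)) λ fs →
    All (Minimal I) fs × AllPairs DisjointA fs × (∀ v → f v ≡ ⋃ fs v)

  decompose : (f : Assignment k m) → Satisfying I f → Decomposition f
  decompose f = go f (⊏-wellFounded f)
    where
    go : (f : Assignment k m) → Acc _⊏_ f → Satisfying I f → Decomposition f
    go f (acc smaller) sat with idZero? f
    ... | yes zero-f = [] , [] , [] , zero-f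
    ... | no nz with minimal-below f sat nz
    ... | g , minimal@(satg , nzg , _) , g≼f with ¬∀⟶∃¬ m _ (λ v → g v ≟F zero) nzg
    ... | w , gw≢0 with go (f ∖ g) (smaller (difference-smaller w gw≢0)) (satisfying-∖ g≼f sat satg)
      where
      -- g is nonzero at w, so f ∖ g vanishes at w while f does not
      difference-smaller : (w : Fin m) → g w ≢ zero → (f ∖ g) ⊏ f
      difference-smaller w gw≢0 = shrink-size (∖-≼ f g) w (⊖-erases (f w) (g w) gw≢0)
        λ fw≡0 → gw≢0 (trans (sym (g≼f w gw≢0)) fw≡0)
    ... | fs , minimals , disjoints , f∖g≗⋃fs =
      g ∷ fs , minimal ∷ minimals , disjoint-⋃ g fs g#⋃fs ∷ disjoints , f≡g⊔⋃fs
      where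
      g#⋃fs : DisjointA g (⋃ fs)
      g#⋃fs v with ∖-disjoint f g v
      ... | inj₁ d≡0  = inj₂ (trans (sym (f∖g≗⋃fs v)) d≡0)
      ... | inj₂ gv≡0 = inj₁ gv≡0
      f≡g⊔⋃fs : ∀ v → f v ≡ g v ⊔ ⋃ fs v
      f≡g⊔⋃fs v = trans (sym (∖-⊔ g≼f v))
        (trans (⊔-comm-disjoint (∖-disjoint f g v)) (cong (g v ⊔_) (f∖g≗⋃fs v)))

  minimal-through : (f : Assignment k m) (v : Fin m) (d : Dom k) → Satisfying I f → f v ≡ d → d ≢ zero →
                    Σ (Assignment k m) λ f′ → Minimal I f′ × f′ v ≡ d
  minimal-through f v d sat fv≡d d≢0 with decompose f sat
  ... | fs , minimals , _ , f≗⋃fs with ⋃-source fs v (λ u≡0 → d≢0 (trans (sym fv≡d) (trans (f≗⋃fs v) u≡0)))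
  ... | g , g∈fs , gv≡u = g , All.lookup minimals g∈fs , trans gv≡u (trans (sym (f≗⋃fs v)) fv≡d)

lemma3p4 : (k : ℕ) (Γ : List (Rel k)) → CC0 Γ → WeaklySeparable Γ →
    (m : ℕ) (I : Instance k Γ m) →
    (∀ f → Satisfying I f →
      Σ (List (Assignment k m)) λ fs →
        All (Minimal I) fs × AllPairs DisjointA fs × (∀ v → f v ≡ ⋃ fs v)) ×
    (∀ f v (d : Dom k) → Satisfying I f → f v ≡ d → d ≢ zero →
      Σ (Assignment k m) λ f' → Minimal I f' × f' v ≡ d)
lemma3p4 k Γ _ ws m I = decompose , minimal-through
  where open MinimalAssignments ws I
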